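{- Let $\mathrm{Eq}(\mathbb{AOL})$ be the set of identities valid in all antiortholattices, and consider the identities (DIST) $x\wedge(y\vee z)\approx(x\wedge y)\vee(x\wedge z)$, (SDM) $(x\wedge y)^{\sim}\approx x^{\sim}\vee y^{\sim}$, (SK) $x\wedge\Diamond y\leq\Box x\vee y$. Let $\mathbb{V}_1=\mathrm{Mod}(\mathrm{Eq}(\mathbb{AOL})\cup\{\mathrm{DIST}\})$, $\mathbb{V}_2=\mathrm{Mod}(\mathrm{Eq}(\mathbb{AOL})\cup\{\mathrm{SDM}\})$, $\mathbb{V}_3=\mathrm{Mod}(\mathrm{Eq}(\mathbb{AOL})\cup\{\mathrm{DIST},\mathrm{SDM}\})$. Then: (i) the variety $V(\mathbf{D}_3)$ generated by $\mathbf{D}_3$ is a proper subvariety of $\mathbb{V}_3$; (ii) $\mathbb{V}_1$ and $\mathbb{V}_2$ are incomparable (neither is contained in the other), hence both are proper subvarieties of $V(\mathbb{AOL})$.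
   Context: A bounded involution lattice is a bounded lattice with an order-reversing involution $'$; it is a pseudo-Kleene algebra if $a\wedge a'\leq b\vee b'$ for all $a,b$. A BZ-lattice is an algebra $\langle B,\wedge,\vee,',^{\sim},0,1\rangle$ whose $^{\sim}$-free reduct is a pseudo-Kleene algebra and which satisfies: $a\wedge a^{\sim}=0$; $a\leq a^{\sim\sim}$; $a\leq b$ implies $b^{\sim}\leq a^{\sim}$; $a^{\sim\prime}=a^{\sim\sim}$. Write $\Diamond x=x^{\sim\sim}$, $\Box x=x'^{\sim}$. A PBZ*-lattice is a BZ-lattice satisfying $(a\wedge a')^{\sim}\leq a^{\sim}\vee a'^{\sim}$ and $(a^{\sim}\vee(\Diamond a\wedge\Diamond b))\wedge\Diamond a\leq\Diamond b$. An antiortholattice is a PBZ*-lattice whose only elements $a$ with $a\wedge a'=0$ are $0$ and $1$; $V(\mathbb{AOL})$ is the variety they generate. For $n\geq1$, $\mathbf{D}_n$ is the $n$-element chain with the unique order-reversing involution $'$ and with $a^{\sim}=0$ for $a>0$, $0^{\sim}=1$ (an antiortholattice). $\mathrm{Mod}(\Sigma)$ denotes the class of algebras of this type satisfying all identities in $\Sigma$. -}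

module Defs where

open import Level using (Level) renaming (suc to lsuc; zero to lzero)
open import Data.Nat using (ℕ)
open import Data.Product using (_×_; Σ-syntax)
open import Data.Sum using (_⊎_)
open import Relation.Binary.PropositionalEquality using (_≡_)
open import Relation.Nullary using (¬_)
open import Algebra.Lattice.Structures using (IsLattice)

infixr 7 _∧ₜ_
infixr 6 _∨ₜ_

record BZAlg : Set₁ where
  field
    Carrier : Set
    _∧_ _∨_ : Carrier → Carrier → Carrier
    _′ _~   : Carrier → Carrier
    𝟘 𝟙     : Carrier

data Term : Set where
  var       : ℕ → Term
  _∧ₜ_ _∨ₜ_ : Term → Term → Term
  _′ₜ _~ₜ   : Term → Term
  𝟘ₜ 𝟙ₜ     : Term

module _ (A : BZAlg) where
  open BZAlg A

  ⟦_⟧ : Term → (ℕ → Carrier) → Carrier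
  ⟦ var i ⟧ ρ   = ρ i
  ⟦ s ∧ₜ t ⟧ ρ  = ⟦ s ⟧ ρ ∧ ⟦ t ⟧ ρ
  ⟦ s ∨ₜ t ⟧ ρ  = ⟦ s ⟧ ρ ∨ ⟦ t ⟧ ρ
  ⟦ s ′ₜ ⟧ ρ    = ⟦ s ⟧ ρ ′
  ⟦ s ~ₜ ⟧ ρ    = ⟦ s ⟧ ρ ~
  ⟦ 𝟘ₜ ⟧ ρ      = 𝟘
  ⟦ 𝟙ₜ ⟧ ρ      = 𝟙

  Sat : Term → Term → Set
  Sat s t = ∀ (ρ : ℕ → Carrier) → ⟦ s ⟧ ρ ≡ ⟦ t ⟧ ρ

module Ops (A : BZAlg) where
  open BZAlg A
  _≤_ : Carrier → Carrier → Set
  a ≤ b = a ∧ b ≡ a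
  ◇ □ : Carrier → Carrier
  ◇ x = (x ~) ~
  □ x = (x ′) ~

record IsAOL (A : BZAlg) : Set₁ where
  open BZAlg A
  open Ops A
  field
    isLattice : IsLattice _≡_ _∨_ _∧_
    𝟘-least   : ∀ a → 𝟘 ≤ a
    𝟙-greatest : ∀ a → a ≤ 𝟙
    ′-invol   : ∀ a → (a ′) ′ ≡ a
    ′-antitone : ∀ a b → a ≤ b → (b ′) ≤ (a ′)
    pKleene   : ∀ a b → (a ∧ (a ′)) ≤ (b ∨ (b ′))
    bz1 : ∀ a → a ∧ (a ~) ≡ 𝟘
    bz2 : ∀ a → a ≤ ((a ~) ~)
    bz3 : ∀ a b → a ≤ b → (b ~) ≤ (a ~)
    bz4 : ∀ a → (a ~) ′ ≡ (a ~) ~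
    star : ∀ a → ((a ∧ (a ′)) ~) ≤ ((a ~) ∨ ((a ′) ~))
    pbz  : ∀ a b → (((a ~) ∨ (◇ a ∧ ◇ b)) ∧ ◇ a) ≤ ◇ b
    aol  : ∀ a → a ∧ (a ′) ≡ 𝟘 → (a ≡ 𝟘) ⊎ (a ≡ 𝟙)

Class : Set₂
Class = BZAlg → Set₁

IdSet : Set₂
IdSet = Term → Term → Set₁

EqOf : Class → IdSet
EqOf K s t = ∀ (B : BZAlg) → K B → Sat B s t

Mod : IdSet → Class
Mod Σ A = ∀ s t → Σ s t → Sat A s t

_∪_ : IdSet → IdSet → IdSet
(E ∪ F) s t = E s t ⊎ F s t

_⊆_ : Class → Class → Set₁
K ⊆ L = ∀ A → K A → L A

_⊂_ : Class → Class → Set₁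
K ⊂ L = (K ⊆ L) × ¬ (L ⊆ K)

-- variety generated by K, as Mod(Eq(K)) (Birkhoff's HSP theorem)
V : Class → Class
V K = Mod (EqOf K)

x y z : Term
x = var 0
y = var 1
z = var 2

data DIST : IdSet where
  dist : DIST (x ∧ₜ (y ∨ₜ z)) ((x ∧ₜ y) ∨ₜ (x ∧ₜ z))

data SDM : IdSet where
  sdm : SDM ((x ∧ₜ y) ~ₜ) ((x ~ₜ) ∨ₜ (y ~ₜ))

AOL : Class
AOL = IsAOL

EqAOL : IdSet
EqAOL = EqOf AOL

𝕍₁ 𝕍₂ 𝕍₃ : Class
𝕍₁ = Mod (EqAOL ∪ DIST)
𝕍₂ = Mod (EqAOL ∪ SDM)
𝕍₃ = Mod (EqAOL ∪ (DIST ∪ SDM))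

data D3 : Set where
  d0 dc d1 : D3

min3 max3 : D3 → D3 → D3
min3 d0 b  = d0
min3 dc d0 = d0
min3 dc b  = dc
min3 d1 b  = b
max3 d0 b  = b
max3 dc d1 = d1
max3 dc b  = dc
max3 d1 b  = d1

inv3 : D3 → D3
inv3 d0 = d1
inv3 dc = dc
inv3 d1 = d0

tilde3 : D3 → D3
tilde3 d0 = d1
tilde3 dc = d0
tilde3 d1 = d0

𝐃₃ : BZAlg
𝐃₃ = record
  { Carrier = D3 ; _∧_ = min3 ; _∨_ = max3 ; _′ = inv3 ; _~ = tilde3
  ; 𝟘 = d0 ; 𝟙 = d1 }

IsD3 : Class
IsD3 B = B ≡ 𝐃₃

module Submission where

-- The theorem compares varieties Mod(Σ) of BZ-lattices, so every claim is
-- either an inclusion or a separation.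
--
-- * Inclusions are purely syntactic facts about Mod and Eq: Mod is antitone
--   in the set of identities, Mod(E ∪ F) is the intersection of Mod E and
--   Mod F, every member of K lies in V K = Mod(Eq K), and V K is the least
--   equational class containing K (V-least).
-- * A separation ¬ (L ⊆ Mod E) is witnessed by one algebra of L that refutes
--   one identity of E (separate).
--
-- The witnesses are four small antiortholattices whose ~ is the trivial
-- one (a~ = 1 iff a = 0): the chains D₃ and D₄, a distributive algebra L₈
-- with two atoms (so SDM fails at a pair of atoms), and the modular
-- non-distributive algebra L₇ obtained by adding a new bottom and a new top
-- to the diamond M₃ (so DIST fails, while 0 is meet-irreducible and SDM
-- holds).
--
-- The theorem then follows: D₃ ∈ 𝕍₃ gives V(D₃) ⊆ 𝕍₃ and D₄ ∈ 𝕍₃ separates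
-- them; L₈ ∈ 𝕍₁ ∖ 𝕍₂ and L₇ ∈ 𝕍₂ ∖ 𝕍₁, and as antiortholattices these two
-- also show that 𝕍₁ and 𝕍₂ are proper in V(AOL).

open import Defs
open import Data.Product using (_×_; _,_)
open import Relation.Nullary using (¬_)

open import Data.Nat using (ℕ)
open import Data.Fin using (Fin; #_)
open import Data.Fin.Properties using (all?) renaming (_≟_ to _≟ᶠ_)
open import Data.Vec using (Vec; _∷_; []; lookup)
open import Data.Bool using (if_then_else_)
open import Data.Sum using (_⊎_; inj₁; inj₂)
open import Relation.Nullary.Decidable
  using (Dec; yes; no; ⌊_⌋; True; toWitness; _×-dec_; _⊎-dec_; _→-dec_)
open import Relation.Unary using (Decidable)
open import Relation.Binary.Definitions using (DecidableEquality)
open import Relation.Binary.PropositionalEquality using (_≡_; refl; cong₂; isEquivalence)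

Mod-antitone : {E F : IdSet} → (∀ {s t} → E s t → F s t) → Mod F ⊆ Mod E
Mod-antitone E⊆F A A⊨F s t e = A⊨F s t (E⊆F e)

Mod-∪ : {E F : IdSet} {A : BZAlg} → Mod E A → Mod F A → Mod (E ∪ F) A
Mod-∪ A⊨E A⊨F s t (inj₁ e) = A⊨E s t e
Mod-∪ A⊨E A⊨F s t (inj₂ f) = A⊨F s t f

K⊆VK : {K : Class} → K ⊆ V K
K⊆VK A A∈K s t s≈t = s≈t A A∈K

V-least : {K : Class} {E : IdSet} → K ⊆ Mod E → V K ⊆ Mod E
V-least K⊆ModE A A∈VK s t e = A∈VK s t (λ B B∈K → K⊆ModE B B∈K s t e)

separate : {L : Class} {E : IdSet} {A : BZAlg} {s t : Term} →
           L A → E s t → ¬ Sat A s t → ¬ (L ⊆ Mod E)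
separate A∈L e A⊭s≈t L⊆ModE = A⊭s≈t (L⊆ModE _ A∈L _ _ e)

module _ (A : BZAlg) where
  open BZAlg A

  Distributive StrongDeMorgan : Set
  Distributive   = ∀ a b c → a ∧ (b ∨ c) ≡ (a ∧ b) ∨ (a ∧ c)
  StrongDeMorgan = ∀ a b → (a ∧ b) ~ ≡ (a ~) ∨ (b ~)

  ⊨DIST : Distributive → Mod DIST A
  ⊨DIST d _ _ dist ρ = d (ρ 0) (ρ 1) (ρ 2)

  ⊨SDM : StrongDeMorgan → Mod SDM A
  ⊨SDM d _ _ sdm ρ = d (ρ 0) (ρ 1)

AOL∈𝕍₁ : {A : BZAlg} → IsAOL A → Distributive A → 𝕍₁ A
AOL∈𝕍₁ {A} aol d = Mod-∪ (K⊆VK A aol) (⊨DIST A d)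

AOL∈𝕍₂ : {A : BZAlg} → IsAOL A → StrongDeMorgan A → 𝕍₂ A
AOL∈𝕍₂ {A} aol e = Mod-∪ (K⊆VK A aol) (⊨SDM A e)

AOL∈𝕍₃ : {A : BZAlg} → IsAOL A → Distributive A → StrongDeMorgan A → 𝕍₃ A
AOL∈𝕍₃ {A} aol d e = Mod-∪ (K⊆VK A aol) (Mod-∪ (⊨DIST A d) (⊨SDM A e))

module Exhaustive (A : BZAlg) (_≟_ : DecidableEquality (BZAlg.Carrier A))
  (∀? : {P : BZAlg.Carrier A → Set} → Decidable P → Dec (∀ a → P a)) where
  open BZAlg A
  open Ops A

  _≤?_ : ∀ a b → Dec (a ≤ b)
  a ≤? b = (a ∧ b) ≟ a

  AOLAxioms : Set
  AOLAxioms =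
    (∀ a b → a ∨ b ≡ b ∨ a) × (∀ a b c → (a ∨ b) ∨ c ≡ a ∨ (b ∨ c)) ×
    (∀ a b → a ∧ b ≡ b ∧ a) × (∀ a b c → (a ∧ b) ∧ c ≡ a ∧ (b ∧ c)) ×
    (∀ a b → a ∨ (a ∧ b) ≡ a) × (∀ a b → a ∧ (a ∨ b) ≡ a) ×
    (∀ a → 𝟘 ≤ a) × (∀ a → a ≤ 𝟙) ×
    (∀ a → (a ′) ′ ≡ a) × (∀ a b → a ≤ b → (b ′) ≤ (a ′)) ×
    (∀ a b → (a ∧ (a ′)) ≤ (b ∨ (b ′))) ×
    (∀ a → a ∧ (a ~) ≡ 𝟘) × (∀ a → a ≤ ((a ~) ~)) ×
    (∀ a b → a ≤ b → (b ~) ≤ (a ~)) × (∀ a → (a ~) ′ ≡ (a ~) ~) ×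
    (∀ a → ((a ∧ (a ′)) ~) ≤ ((a ~) ∨ ((a ′) ~))) ×
    (∀ a b → (((a ~) ∨ (◇ a ∧ ◇ b)) ∧ ◇ a) ≤ ◇ b) ×
    (∀ a → a ∧ (a ′) ≡ 𝟘 → (a ≡ 𝟘) ⊎ (a ≡ 𝟙))

  aolAxioms? : Dec AOLAxioms
  aolAxioms? =
    (∀? λ a → ∀? λ b → (a ∨ b) ≟ (b ∨ a)) ×-dec
    (∀? λ a → ∀? λ b → ∀? λ c → ((a ∨ b) ∨ c) ≟ (a ∨ (b ∨ c))) ×-dec
    (∀? λ a → ∀? λ b → (a ∧ b) ≟ (b ∧ a)) ×-dec
    (∀? λ a → ∀? λ b → ∀? λ c → ((a ∧ b) ∧ c) ≟ (a ∧ (b ∧ c))) ×-dec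
    (∀? λ a → ∀? λ b → (a ∨ (a ∧ b)) ≟ a) ×-dec
    (∀? λ a → ∀? λ b → (a ∧ (a ∨ b)) ≟ a) ×-dec
    (∀? λ a → 𝟘 ≤? a) ×-dec
    (∀? λ a → a ≤? 𝟙) ×-dec
    (∀? λ a → ((a ′) ′) ≟ a) ×-dec
    (∀? λ a → ∀? λ b → (a ≤? b) →-dec ((b ′) ≤? (a ′))) ×-dec
    (∀? λ a → ∀? λ b → (a ∧ (a ′)) ≤? (b ∨ (b ′))) ×-dec
    (∀? λ a → (a ∧ (a ~)) ≟ 𝟘) ×-dec
    (∀? λ a → a ≤? ((a ~) ~)) ×-dec
    (∀? λ a → ∀? λ b → (a ≤? b) →-dec ((b ~) ≤? (a ~))) ×-dec
    (∀? λ a → ((a ~) ′) ≟ ((a ~) ~)) ×-dec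
    (∀? λ a → ((a ∧ (a ′)) ~) ≤? ((a ~) ∨ ((a ′) ~))) ×-dec
    (∀? λ a → ∀? λ b → (((a ~) ∨ (◇ a ∧ ◇ b)) ∧ ◇ a) ≤? ◇ b) ×-dec
    (∀? λ a → ((a ∧ (a ′)) ≟ 𝟘) →-dec ((a ≟ 𝟘) ⊎-dec (a ≟ 𝟙)))

  fromAxioms : AOLAxioms → IsAOL A
  fromAxioms (∨-comm , ∨-assoc , ∧-comm , ∧-assoc , ∨-absorbs-∧ , ∧-absorbs-∨ ,
              𝟘-least , 𝟙-greatest , ′-invol , ′-antitone , pKleene ,
              bz1 , bz2 , bz3 , bz4 , star , pbz , aol) = record
    { isLattice = record
      { isEquivalence = isEquivalence
      ; ∨-comm = ∨-comm ; ∨-assoc = ∨-assoc ; ∨-cong = cong₂ _∨_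
      ; ∧-comm = ∧-comm ; ∧-assoc = ∧-assoc ; ∧-cong = cong₂ _∧_
      ; absorptive = ∨-absorbs-∧ , ∧-absorbs-∨ }
    ; 𝟘-least = 𝟘-least ; 𝟙-greatest = 𝟙-greatest
    ; ′-invol = ′-invol ; ′-antitone = ′-antitone ; pKleene = pKleene
    ; bz1 = bz1 ; bz2 = bz2 ; bz3 = bz3 ; bz4 = bz4
    ; star = star ; pbz = pbz ; aol = aol }

  isAOL : {ok : True aolAxioms?} → IsAOL A
  isAOL {ok} = fromAxioms (toWitness ok)

  distributive : {ok : True (∀? λ a → ∀? λ b → ∀? λ c →
                               (a ∧ (b ∨ c)) ≟ ((a ∧ b) ∨ (a ∧ c)))} →
                 Distributive A
  distributive {ok} = toWitness ok

  strongDeMorgan : {ok : True (∀? λ a → ∀? λ b → ((a ∧ b) ~) ≟ ((a ~) ∨ (b ~)))} →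
                   StrongDeMorgan A
  strongDeMorgan {ok} = toWitness ok

module TableAlgebra {n : ℕ} (meets joins : Vec (Vec (Fin n) n) n)
                    (inverses : Vec (Fin n) n) (bottom top : Fin n) where
  algebra : BZAlg
  algebra = record
    { Carrier = Fin n
    ; _∧_ = λ a b → lookup (lookup meets a) b
    ; _∨_ = λ a b → lookup (lookup joins a) b
    ; _′  = lookup inverses
    ; _~  = λ a → if ⌊ a ≟ᶠ bottom ⌋ then top else bottom
    ; 𝟘 = bottom ; 𝟙 = top }

  open Exhaustive algebra _≟ᶠ_ all? public

-- The four-element chain D₄ : 0 < 1 < 2 < 3, with i′ = 3 - i.
module D₄ = TableAlgebra
  ((# 0 ∷ # 0 ∷ # 0 ∷ # 0 ∷ []) ∷
   (# 0 ∷ # 1 ∷ # 1 ∷ # 1 ∷ []) ∷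
   (# 0 ∷ # 1 ∷ # 2 ∷ # 2 ∷ []) ∷
   (# 0 ∷ # 1 ∷ # 2 ∷ # 3 ∷ []) ∷ [])
  ((# 0 ∷ # 1 ∷ # 2 ∷ # 3 ∷ []) ∷
   (# 1 ∷ # 1 ∷ # 2 ∷ # 3 ∷ []) ∷
   (# 2 ∷ # 2 ∷ # 2 ∷ # 3 ∷ []) ∷
   (# 3 ∷ # 3 ∷ # 3 ∷ # 3 ∷ []) ∷ [])
  (# 3 ∷ # 2 ∷ # 1 ∷ # 0 ∷ [])
  (# 0) (# 3)

-- L₇ : 0 < 1 < {2, 3, 4} < 5 < 6, where 1, {2, 3, 4}, 5 form a diamond M₃;
-- the involution swaps 2 and 3 and fixes 4.
module L₇ = TableAlgebra
  ((# 0 ∷ # 0 ∷ # 0 ∷ # 0 ∷ # 0 ∷ # 0 ∷ # 0 ∷ []) ∷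
   (# 0 ∷ # 1 ∷ # 1 ∷ # 1 ∷ # 1 ∷ # 1 ∷ # 1 ∷ []) ∷
   (# 0 ∷ # 1 ∷ # 2 ∷ # 1 ∷ # 1 ∷ # 2 ∷ # 2 ∷ []) ∷
   (# 0 ∷ # 1 ∷ # 1 ∷ # 3 ∷ # 1 ∷ # 3 ∷ # 3 ∷ []) ∷
   (# 0 ∷ # 1 ∷ # 1 ∷ # 1 ∷ # 4 ∷ # 4 ∷ # 4 ∷ []) ∷
   (# 0 ∷ # 1 ∷ # 2 ∷ # 3 ∷ # 4 ∷ # 5 ∷ # 5 ∷ []) ∷
   (# 0 ∷ # 1 ∷ # 2 ∷ # 3 ∷ # 4 ∷ # 5 ∷ # 6 ∷ []) ∷ [])
  ((# 0 ∷ # 1 ∷ # 2 ∷ # 3 ∷ # 4 ∷ # 5 ∷ # 6 ∷ []) ∷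
   (# 1 ∷ # 1 ∷ # 2 ∷ # 3 ∷ # 4 ∷ # 5 ∷ # 6 ∷ []) ∷
   (# 2 ∷ # 2 ∷ # 2 ∷ # 5 ∷ # 5 ∷ # 5 ∷ # 6 ∷ []) ∷
   (# 3 ∷ # 3 ∷ # 5 ∷ # 3 ∷ # 5 ∷ # 5 ∷ # 6 ∷ []) ∷
   (# 4 ∷ # 4 ∷ # 5 ∷ # 5 ∷ # 4 ∷ # 5 ∷ # 6 ∷ []) ∷
   (# 5 ∷ # 5 ∷ # 5 ∷ # 5 ∷ # 5 ∷ # 5 ∷ # 6 ∷ []) ∷
   (# 6 ∷ # 6 ∷ # 6 ∷ # 6 ∷ # 6 ∷ # 6 ∷ # 6 ∷ []) ∷ [])
  (# 6 ∷ # 5 ∷ # 3 ∷ # 2 ∷ # 4 ∷ # 1 ∷ # 0 ∷ [])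
  (# 0) (# 6)

-- L₈ : the square {0, 1, 2, 3} (atoms 1, 2) below 4, below the square
-- {4, 5, 6, 7} (atoms 5, 6); the involution reverses the order, swapping
-- 1 with 5, 2 with 6 and 3 with 4.
module L₈ = TableAlgebra
  ((# 0 ∷ # 0 ∷ # 0 ∷ # 0 ∷ # 0 ∷ # 0 ∷ # 0 ∷ # 0 ∷ []) ∷
   (# 0 ∷ # 1 ∷ # 0 ∷ # 1 ∷ # 1 ∷ # 1 ∷ # 1 ∷ # 1 ∷ []) ∷
   (# 0 ∷ # 0 ∷ # 2 ∷ # 2 ∷ # 2 ∷ # 2 ∷ # 2 ∷ # 2 ∷ []) ∷
   (# 0 ∷ # 1 ∷ # 2 ∷ # 3 ∷ # 3 ∷ # 3 ∷ # 3 ∷ # 3 ∷ []) ∷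
   (# 0 ∷ # 1 ∷ # 2 ∷ # 3 ∷ # 4 ∷ # 4 ∷ # 4 ∷ # 4 ∷ []) ∷
   (# 0 ∷ # 1 ∷ # 2 ∷ # 3 ∷ # 4 ∷ # 5 ∷ # 4 ∷ # 5 ∷ []) ∷
   (# 0 ∷ # 1 ∷ # 2 ∷ # 3 ∷ # 4 ∷ # 4 ∷ # 6 ∷ # 6 ∷ []) ∷
   (# 0 ∷ # 1 ∷ # 2 ∷ # 3 ∷ # 4 ∷ # 5 ∷ # 6 ∷ # 7 ∷ []) ∷ [])
  ((# 0 ∷ # 1 ∷ # 2 ∷ # 3 ∷ # 4 ∷ # 5 ∷ # 6 ∷ # 7 ∷ []) ∷
   (# 1 ∷ # 1 ∷ # 3 ∷ # 3 ∷ # 4 ∷ # 5 ∷ # 6 ∷ # 7 ∷ []) ∷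
   (# 2 ∷ # 3 ∷ # 2 ∷ # 3 ∷ # 4 ∷ # 5 ∷ # 6 ∷ # 7 ∷ []) ∷
   (# 3 ∷ # 3 ∷ # 3 ∷ # 3 ∷ # 4 ∷ # 5 ∷ # 6 ∷ # 7 ∷ []) ∷
   (# 4 ∷ # 4 ∷ # 4 ∷ # 4 ∷ # 4 ∷ # 5 ∷ # 6 ∷ # 7 ∷ []) ∷
   (# 5 ∷ # 5 ∷ # 5 ∷ # 5 ∷ # 5 ∷ # 5 ∷ # 7 ∷ # 7 ∷ []) ∷
   (# 6 ∷ # 6 ∷ # 6 ∷ # 6 ∷ # 6 ∷ # 7 ∷ # 6 ∷ # 7 ∷ []) ∷
   (# 7 ∷ # 7 ∷ # 7 ∷ # 7 ∷ # 7 ∷ # 7 ∷ # 7 ∷ # 7 ∷ []) ∷ [])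
  (# 7 ∷ # 5 ∷ # 6 ∷ # 4 ∷ # 3 ∷ # 1 ∷ # 2 ∷ # 0 ∷ [])
  (# 0) (# 7)

_≟₃_ : DecidableEquality D3
d0 ≟₃ d0 = yes refl
d0 ≟₃ dc = no λ ()
d0 ≟₃ d1 = no λ ()
dc ≟₃ d0 = no λ ()
dc ≟₃ dc = yes refl
dc ≟₃ d1 = no λ ()
d1 ≟₃ d0 = no λ ()
d1 ≟₃ dc = no λ ()
d1 ≟₃ d1 = yes refl

all₃? : {P : D3 → Set} → Decidable P → Dec (∀ a → P a)
all₃? P? with P? d0 | P? dc | P? d1
... | yes p₀ | yes p_c | yes p₁ = yes λ { d0 → p₀ ; dc → p_c ; d1 → p₁ }
... | no ¬p₀ | _       | _      = no λ p → ¬p₀ (p d0)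
... | yes _  | no ¬p_c | _      = no λ p → ¬p_c (p dc)
... | yes _  | yes _   | no ¬p₁ = no λ p → ¬p₁ (p d1)

module D₃ = Exhaustive 𝐃₃ _≟₃_ all₃?

D₃∈𝕍₃ : 𝕍₃ 𝐃₃
D₃∈𝕍₃ = AOL∈𝕍₃ D₃.isAOL D₃.distributive D₃.strongDeMorgan

D₄∈𝕍₃ : 𝕍₃ D₄.algebra
D₄∈𝕍₃ = AOL∈𝕍₃ D₄.isAOL D₄.distributive D₄.strongDeMorgan

L₇∈𝕍₂ : 𝕍₂ L₇.algebra
L₇∈𝕍₂ = AOL∈𝕍₂ L₇.isAOL L₇.strongDeMorgan

L₈∈𝕍₁ : 𝕍₁ L₈.algebra
L₈∈𝕍₁ = AOL∈𝕍₁ L₈.isAOL L₈.distributive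

-- The identity x ∨ x′ ≈ x ∨ x~ holds in D₃ (the middle element is its own
-- complement, and 0, 1 have 0′ = 0~, 1′ = 1~), but fails in D₄ at x = 1.

x∨x′ x∨x~ : Term
x∨x′ = x ∨ₜ (x ′ₜ)
x∨x~ = x ∨ₜ (x ~ₜ)

D₃⊨x∨x′≈x∨x~ : EqOf IsD3 x∨x′ x∨x~
D₃⊨x∨x′≈x∨x~ .𝐃₃ refl ρ with ρ 0
... | d0 = refl
... | dc = refl
... | d1 = refl

D₄⊭x∨x′≈x∨x~ : ¬ Sat D₄.algebra x∨x′ x∨x~
D₄⊭x∨x′≈x∨x~ D₄⊨ with D₄⊨ (λ _ → # 1)
... | ()

-- DIST fails in L₇ at the diamond: 2 ∧ (3 ∨ 4) = 2 but (2 ∧ 3) ∨ (2 ∧ 4) = 1.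
L₇⊭DIST : ¬ Sat L₇.algebra (x ∧ₜ (y ∨ₜ z)) ((x ∧ₜ y) ∨ₜ (x ∧ₜ z))
L₇⊭DIST L₇⊨ with L₇⊨ (λ { 0 → # 2 ; 1 → # 3 ; _ → # 4 })
... | ()

-- SDM fails in L₈ at the atoms: (1 ∧ 2)~ = 0~ = 1 but 1~ ∨ 2~ = 0.
L₈⊭SDM : ¬ Sat L₈.algebra ((x ∧ₜ y) ~ₜ) ((x ~ₜ) ∨ₜ (y ~ₜ))
L₈⊭SDM L₈⊨ with L₈⊨ (λ { 0 → # 1 ; _ → # 2 })
... | ()

mainTheorem2 :
    (V IsD3 ⊂ 𝕍₃)
    × ((¬ (𝕍₁ ⊆ 𝕍₂) × ¬ (𝕍₂ ⊆ 𝕍₁))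
       × ((𝕍₁ ⊂ V AOL) × (𝕍₂ ⊂ V AOL)))
mainTheorem2 =
  ( (V-least (λ { _ refl → D₃∈𝕍₃ }) , separate {s = x∨x′} {t = x∨x~} D₄∈𝕍₃ D₃⊨x∨x′≈x∨x~ D₄⊭x∨x′≈x∨x~)
  , ( (separate L₈∈𝕍₁ (inj₂ sdm) L₈⊭SDM , separate L₇∈𝕍₂ (inj₂ dist) L₇⊭DIST)
    , ( (Mod-antitone inj₁ , separate (K⊆VK _ L₇.isAOL) (inj₂ dist) L₇⊭DIST)
      , (Mod-antitone inj₁ , separate (K⊆VK _ L₈.isAOL) (inj₂ sdm) L₈⊭SDM) ) ) )
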